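{- Let $\mathsf L$ be any of the logics $\mathsf{N}_\preccurlyeq$, $\mathsf{NN}_\preccurlyeq$, $\mathsf{NT}_\preccurlyeq$, $\mathsf{NW}_\preccurlyeq$, $\mathsf{NC}_\preccurlyeq$ or any of their U- or A-extensions, and let $M_{\mathsf L}=\langle W_{\mathsf L},N_{\mathsf L},V_{\mathsf L}\rangle$ be the canonical model for $\mathsf L$. Then for all formulas $A$ and all $\Phi\in W_{\mathsf L}$, $M_{\mathsf L},\Phi\Vdash A$ if and only if $A\in\Phi$.
   Context: Language: formulas $A ::= p \mid \bot \mid A\to A \mid A \preccurlyeq A$ over countably many atoms $Atm$; $\top,\neg,\wedge,\vee$ defined as usual. Forcing in a structure $\langle W,N,V\rangle$ ($N:W\to\mathcal P(\mathcal P(W))$, $V:Atm\to\mathcal P(W)$): $w\Vdash p$ iff $w\in V(p)$; $w\not\Vdash\bot$; $w\Vdash B\to C$ iff $w\Vdash B$ implies $w\Vdash C$; $w\Vdash B\preccurlyeq C$ iff for all $\alpha\in N(w)$, if some $v\in\alpha$ forces $C$ then some $u\in\alpha$ forces $B$. Axioms and rules: (cpr) from $A\to B$ infer $B\preccurlyeq A$; (tr) $(A\preccurlyeq B)\wedge(B\preccurlyeq C)\to(A\preccurlyeq C)$; (or) $(A\preccurlyeq B)\wedge(A\preccurlyeq C)\to(A\preccurlyeq B\vee C)$; (n) $\neg(\bot\preccurlyeq\top)$; (t) $(\bot\preccurlyeq A)\to\neg A$; (w) $A\to(A\preccurlyeq\top)$; (c) $(A\preccurlyeq\top)\to A$; (u$-$)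 $\neg(\bot\preccurlyeq A)\to(\bot\preccurlyeq(\bot\preccurlyeq A))$; (u) $(\bot\preccurlyeq A)\to(\bot\preccurlyeq\neg(\bot\preccurlyeq A))$; (a$-$) $(A\preccurlyeq B)\to(\bot\preccurlyeq\neg(A\preccurlyeq B))$; (a) $\neg(A\preccurlyeq B)\to(\bot\preccurlyeq(A\preccurlyeq B))$. $\mathsf{N}_\preccurlyeq$ = classical propositional logic plus tr, or, cpr; $\mathsf{NN}_\preccurlyeq=\mathsf N_\preccurlyeq+$n; $\mathsf{NT}_\preccurlyeq=\mathsf N_\preccurlyeq+$t; $\mathsf{NW}_\preccurlyeq=\mathsf{NT}_\preccurlyeq+$w; $\mathsf{NC}_\preccurlyeq=\mathsf{NW}_\preccurlyeq+$c; the U-extension adds u$-$,u and the A-extension adds a$-$,a. Derivability: finite sequences of axioms, modus ponens, cpr; consistency and maximal consistency (maxcons) are defined as usual from deducibility ($A$ deducible from $\Phi$ iff $\vdash_{\mathsf L}B_1\wedge\dots\wedge B_n\to A$ for finitely many $B_i\in\Phi$). A set $\Sigma$ is a cut around maxcons $\Phi$ if for all finite $\{B_1,\dots,B_n\}\subseteq\Sigma$ and $A\notin\Sigma$, $(B_1\vee\dots\vee B_n)\preccurlyeq A\notin\Phi$; $\Sigma^c$ is the set of maxcons $\Psi$ with $\Psi\cap\Sigma=\emptyset$. The canonical model: $W_{\mathsf L}$ is the set of all $\mathsf L$-maxcons sets; $N_{\mathsf L}(\Phi)=\{\Sigma^c\mid \Sigma$ is a cut around $\Phi$ and $\Sigma^c\neq\emptyset\}$;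 $V_{\mathsf L}(p)=\{\Phi\in W_{\mathsf L}\mid p\in\Phi\}$. -}

module Defs where

open import Level using (Level; 0ℓ) renaming (suc to lsuc)
open import Data.Nat using (ℕ)
open import Data.List using (List; []; _∷_; foldr)
open import Data.List.Relation.Unary.All using (All)
open import Data.Product using (Σ; Σ-syntax; ∃; _×_; _,_; proj₁)
open import Data.Empty using (⊥)
open import Function.Bundles using (_⇔_)
open import Relation.Nullary using (¬_)
open import Relation.Binary.PropositionalEquality using (_≡_)

infixr 5 _⇒_
infix 6 _≼_

data Form : Set where
  atom : ℕ → Form
  ⊥'   : Form
  _⇒_  : Form → Form → Form
  _≼_  : Form → Form → Form

¬' : Form → Form
¬' A = A ⇒ ⊥'

⊤' : Form
⊤' = ⊥' ⇒ ⊥'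

_∨'_ : Form → Form → Form
A ∨' B = ¬' A ⇒ B

_∧'_ : Form → Form → Form
A ∧' B = ¬' (A ⇒ ¬' B)

⋀ : List Form → Form
⋀ = foldr _∧'_ ⊤'

⋁ : List Form → Form
⋁ = foldr _∨'_ ⊥'

data Base : Set where
  N NN NT NW NC : Base

data Ext : Set where
  plain U-ext A-ext : Ext

record Logic : Set where
  constructor logic
  field
    base : Base
    ext  : Ext
open Logic public

data HasN : Base → Set where
  nn : HasN NN

data HasT : Base → Set where
  nt : HasT NT
  nw : HasT NW
  nc : HasT NC

data HasW : Base → Set where
  nw : HasW NW
  nc : HasW NC

data HasC : Base → Set where
  nc : HasC NC

data Axiom (L : Logic) : Form → Set where
  ax-K   : ∀ A B → Axiom L (A ⇒ B ⇒ A)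
  ax-S   : ∀ A B C → Axiom L ((A ⇒ B ⇒ C) ⇒ (A ⇒ B) ⇒ A ⇒ C)
  ax-DN  : ∀ A → Axiom L (¬' (¬' A) ⇒ A)
  ax-tr  : ∀ A B C → Axiom L (((A ≼ B) ∧' (B ≼ C)) ⇒ (A ≼ C))
  ax-or  : ∀ A B C → Axiom L (((A ≼ B) ∧' (A ≼ C)) ⇒ (A ≼ (B ∨' C)))
  ax-n   : HasN (base L) → Axiom L (¬' (⊥' ≼ ⊤'))
  ax-t   : HasT (base L) → ∀ A → Axiom L ((⊥' ≼ A) ⇒ ¬' A)
  ax-w   : HasW (base L) → ∀ A → Axiom L (A ⇒ (A ≼ ⊤'))
  ax-c   : HasC (base L) → ∀ A → Axiom L ((A ≼ ⊤') ⇒ A)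
  ax-u⁻  : ext L ≡ U-ext → ∀ A →
           Axiom L (¬' (⊥' ≼ A) ⇒ (⊥' ≼ (⊥' ≼ A)))
  ax-u   : ext L ≡ U-ext → ∀ A →
           Axiom L ((⊥' ≼ A) ⇒ (⊥' ≼ ¬' (⊥' ≼ A)))
  ax-a⁻  : ext L ≡ A-ext → ∀ A B →
           Axiom L ((A ≼ B) ⇒ (⊥' ≼ ¬' (A ≼ B)))
  ax-a   : ext L ≡ A-ext → ∀ A B →
           Axiom L (¬' (A ≼ B) ⇒ (⊥' ≼ (A ≼ B)))

infix 3 _⊢_
data _⊢_ (L : Logic) : Form → Set where
  ax  : ∀ {A} → Axiom L A → L ⊢ A
  mp  : ∀ {A B} → L ⊢ (A ⇒ B) → L ⊢ A → L ⊢ B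
  cpr : ∀ {A B} → L ⊢ (A ⇒ B) → L ⊢ (B ≼ A)

FSet : Set₁
FSet = Form → Set

_⊆F_ : FSet → FSet → Set
Φ ⊆F Ψ = ∀ A → Φ A → Ψ A

Deducible : Logic → FSet → Form → Set
Deducible L Φ A = Σ[ Bs ∈ List Form ] (All Φ Bs × (L ⊢ (⋀ Bs ⇒ A)))

Consistent : Logic → FSet → Set
Consistent L Φ = ¬ Deducible L Φ ⊥'

MaxCons : Logic → FSet → Set₁
MaxCons L Φ = Consistent L Φ × (∀ Ψ → Φ ⊆F Ψ → Consistent L Ψ → Ψ ⊆F Φ)

record Structure : Set₂ where
  field
    World : Set₁
    Nb    : World → (World → Set) → Set₁
    Val   : ℕ → World → Set

module _ (M : Structure) where
  open Structure M

  infix 2 _⊩_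
  _⊩_ : World → Form → Set₁
  w ⊩ atom p = Level.Lift _ (Val p w)
  w ⊩ ⊥'     = Level.Lift _ ⊥
  w ⊩ (B ⇒ C) = w ⊩ B → w ⊩ C
  w ⊩ (B ≼ C) = ∀ (α : World → Set) → Nb w α →
                (Σ[ v ∈ World ] (α v × (v ⊩ C))) →
                Σ[ u ∈ World ] (α u × (u ⊩ B))

WL : Logic → Set₁
WL L = Σ FSet (MaxCons L)

Cut : (L : Logic) → WL L → FSet → Set
Cut L (Φ , _) S =
  ∀ (Bs : List Form) (A : Form) → All S Bs → ¬ S A → ¬ Φ (⋁ Bs ≼ A)

Compl : (L : Logic) → FSet → WL L → Set
Compl L S (Ψ , _) = ∀ A → S A → ¬ Ψ A

NL : (L : Logic) → WL L → (WL L → Set) → Set₁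
NL L Φ α = Σ[ S ∈ FSet ] (Cut L Φ S
           × (Σ[ Ψ ∈ WL L ] Compl L S Ψ)
           × (∀ Ψ → α Ψ ⇔ Compl L S Ψ))

VL : (L : Logic) → ℕ → WL L → Set
VL L p (Φ , _) = Φ (atom p)

Canonical : Logic → Structure
Canonical L = record { World = WL L ; Nb = NL L ; Val = VL L }

-- Compactness gives a
-- separation principle: for a set S of formulas, some maximal consistent set contains A
-- and avoids S unless ⊢ A → ⋁Ds for a finite Ds ⊆ S. If B ≼ C ∈ Φ and Sᶜ is a
-- neighbourhood of Φ with a C-world, a derivation ⊢ B → ⋁Ds would give ⋁Ds ≼ B by (cpr)
-- and then ⋁Ds ≼ C by (tr), contradicting that S is a cut; so Sᶜ has a B-world.
-- Conversely, if B ≼ C ∉ Φ, then S = {D ∣ B ≼ D ∈ Φ} is a cut by (or) and (tr) and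
-- contains B by (cpr), and separating C from S yields a neighbourhood of Φ with a
-- C-world but no B-world. Only classical logic, (cpr), (tr) and (or) are used, so the
-- argument is uniform in L.
module Submission where

open import Defs
open import Level using (0ℓ; Lift; lift; lower) renaming (suc to lsuc)
open import Axiom.ExcludedMiddle using (ExcludedMiddle)
open import Data.Empty using (⊥; ⊥-elim)
open import Data.List using (List; []; _∷_; _++_; cartesianProductWith)
open import Data.List.Membership.Propositional using (_∈_)
open import Data.List.Membership.Propositional.Properties
  using (∈-++⁺ˡ; ∈-++⁺ʳ; ∈-cartesianProductWith⁺)
open import Data.List.Relation.Unary.All using (All; []; _∷_)
open import Data.List.Relation.Unary.All.Properties using (++⁺)
open import Data.List.Relation.Unary.Any using (here; there)
open import Data.Nat using (ℕ; zero; suc; _⊔_; _≤′_; ≤′-refl; ≤′-step)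
open import Data.Nat.Properties using (≤⇒≤′; m≤m⊔n; m≤n⊔m)
open import Data.Product using (proj₁; proj₂; Σ-syntax; _×_; _,_)
open import Data.Sum using (_⊎_; inj₁; inj₂)
open import Function using (id)
open import Function.Bundles using (_⇔_; mk⇔; Equivalence)
open import Relation.Binary.PropositionalEquality using (_≡_; refl)
open import Relation.Nullary using (¬_; Dec; yes; no)
open import Relation.Nullary.Decidable using (map′)

open Equivalence using (to; from)

formsBelow : ℕ → List Form
formsBelow zero    = ⊥' ∷ []
formsBelow (suc n) = atom n ∷ formsBelow n
  ++ cartesianProductWith _⇒_ (formsBelow n) (formsBelow n)
  ++ cartesianProductWith _≼_ (formsBelow n) (formsBelow n)

formsBelow-mono : ∀ {m n A} → m ≤′ n → A ∈ formsBelow m → A ∈ formsBelow n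
formsBelow-mono ≤′-refl       A∈ = A∈
formsBelow-mono (≤′-step m≤n) A∈ = there (∈-++⁺ˡ (formsBelow-mono m≤n A∈))

∈-formsBelow : ∀ A → Σ[ n ∈ ℕ ] A ∈ formsBelow n
∈-formsBelow (atom p) = suc p , here refl
∈-formsBelow ⊥'       = zero , here refl
∈-formsBelow (B ⇒ C) with ∈-formsBelow B | ∈-formsBelow C
... | m , B∈ | n , C∈ = suc (m ⊔ n) , there (∈-++⁺ʳ (formsBelow (m ⊔ n)) (∈-++⁺ˡ
  (∈-cartesianProductWith⁺ _⇒_ (formsBelow-mono (≤⇒≤′ (m≤m⊔n m n)) B∈)
                               (formsBelow-mono (≤⇒≤′ (m≤n⊔m m n)) C∈))))
∈-formsBelow (B ≼ C) with ∈-formsBelow B | ∈-formsBelow C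
... | m , B∈ | n , C∈ = suc (m ⊔ n) , there (∈-++⁺ʳ (formsBelow (m ⊔ n)) (∈-++⁺ʳ _
  (∈-cartesianProductWith⁺ _≼_ (formsBelow-mono (≤⇒≤′ (m≤m⊔n m n)) B∈)
                               (formsBelow-mono (≤⇒≤′ (m≤n⊔m m n)) C∈))))

∅ : FSet
∅ _ = ⊥

_▷_ : FSet → Form → FSet
(Γ ▷ A) X = X ≡ A ⊎ Γ X

_∪_ : FSet → FSet → FSet
(Γ ∪ Δ) X = Γ X ⊎ Δ X

negations : FSet → FSet
negations S X = Σ[ D ∈ Form ] (S D × X ≡ ¬' D)

module _ (L : Logic) where

  infix 3 _⊢ₕ_
  data _⊢ₕ_ (Γ : FSet) : Form → Set where
    hyp : ∀ {A} → Γ A → Γ ⊢ₕ A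
    thm : ∀ {A} → L ⊢ A → Γ ⊢ₕ A
    mpₕ : ∀ {A B} → Γ ⊢ₕ (A ⇒ B) → Γ ⊢ₕ A → Γ ⊢ₕ B

  Consistentₕ : FSet → Set
  Consistentₕ Γ = ¬ (Γ ⊢ₕ ⊥')

  ⊢ₕ-mono : ∀ {Γ Δ A} → Γ ⊆F Δ → Γ ⊢ₕ A → Δ ⊢ₕ A
  ⊢ₕ-mono Γ⊆Δ (hyp h)   = hyp (Γ⊆Δ _ h)
  ⊢ₕ-mono Γ⊆Δ (thm p)   = thm p
  ⊢ₕ-mono Γ⊆Δ (mpₕ d e) = mpₕ (⊢ₕ-mono Γ⊆Δ d) (⊢ₕ-mono Γ⊆Δ e)

  ⊢ₕ-cut : ∀ {Γ Δ A} → (∀ X → Γ X → Δ ⊢ₕ X) → Γ ⊢ₕ A → Δ ⊢ₕ A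
  ⊢ₕ-cut Δ⊢Γ (hyp h)   = Δ⊢Γ _ h
  ⊢ₕ-cut Δ⊢Γ (thm p)   = thm p
  ⊢ₕ-cut Δ⊢Γ (mpₕ d e) = mpₕ (⊢ₕ-cut Δ⊢Γ d) (⊢ₕ-cut Δ⊢Γ e)

  ⊢ₕ-weaken : ∀ {Γ A B} → Γ ⊢ₕ B → (Γ ▷ A) ⊢ₕ B
  ⊢ₕ-weaken = ⊢ₕ-mono (λ _ → inj₂)

  ⊢ₕ-closed : ∀ {A} → ∅ ⊢ₕ A → L ⊢ A
  ⊢ₕ-closed (hyp ())
  ⊢ₕ-closed (thm p)   = p
  ⊢ₕ-closed (mpₕ d e) = mp (⊢ₕ-closed d) (⊢ₕ-closed e)

  ⊢-identity : ∀ A → L ⊢ A ⇒ A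
  ⊢-identity A = mp (mp (ax (ax-S A (A ⇒ A) A)) (ax (ax-K A (A ⇒ A)))) (ax (ax-K A A))

  deduction : ∀ {Γ A B} → (Γ ▷ A) ⊢ₕ B → Γ ⊢ₕ A ⇒ B
  deduction (hyp (inj₁ refl)) = thm (⊢-identity _)
  deduction (hyp (inj₂ h))    = mpₕ (thm (ax (ax-K _ _))) (hyp h)
  deduction (thm p)           = mpₕ (thm (ax (ax-K _ _))) (thm p)
  deduction {A = A} (mpₕ {C} {D} d e) =
    mpₕ (mpₕ (thm (ax (ax-S A C D))) (deduction d)) (deduction e)

  ¬¬-elimₕ : ∀ {Γ A} → Γ ⊢ₕ ¬' (¬' A) → Γ ⊢ₕ A
  ¬¬-elimₕ = mpₕ (thm (ax (ax-DN _)))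

  ⊥-elimₕ : ∀ {Γ A} → Γ ⊢ₕ ⊥' → Γ ⊢ₕ A
  ⊥-elimₕ d = ¬¬-elimₕ (mpₕ (thm (ax (ax-K _ _))) d)

  ∧-introₕ : ∀ {Γ A B} → Γ ⊢ₕ A → Γ ⊢ₕ B → Γ ⊢ₕ A ∧' B
  ∧-introₕ d e = deduction (mpₕ (mpₕ (hyp (inj₁ refl)) (⊢ₕ-weaken d)) (⊢ₕ-weaken e))

  ∧-elimˡₕ : ∀ {Γ A B} → Γ ⊢ₕ A ∧' B → Γ ⊢ₕ A
  ∧-elimˡₕ d = ¬¬-elimₕ (deduction (mpₕ (⊢ₕ-weaken d) (deduction (deduction
    (mpₕ (hyp (inj₂ (inj₂ (inj₁ refl)))) (hyp (inj₂ (inj₁ refl))))))))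

  ∧-elimʳₕ : ∀ {Γ A B} → Γ ⊢ₕ A ∧' B → Γ ⊢ₕ B
  ∧-elimʳₕ d = ¬¬-elimₕ (deduction (mpₕ (⊢ₕ-weaken d) (deduction (hyp (inj₂ (inj₁ refl))))))

  ⊢ₕ-⋀ : ∀ {Γ Bs} → All Γ Bs → Γ ⊢ₕ ⋀ Bs
  ⊢ₕ-⋀ []       = thm (⊢-identity ⊥')
  ⊢ₕ-⋀ (p ∷ ps) = ∧-introₕ (hyp p) (⊢ₕ-⋀ ps)

  deducible⇒⊢ₕ : ∀ {Γ A} → Deducible L Γ A → Γ ⊢ₕ A
  deducible⇒⊢ₕ (Bs , Bs⊆Γ , ⊢⋀Bs⇒A) = mpₕ (thm ⊢⋀Bs⇒A) (⊢ₕ-⋀ Bs⊆Γ)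

  finite-support : ∀ {Γ A} → Γ ⊢ₕ A → Σ[ Bs ∈ List Form ] (All Γ Bs × (_∈ Bs) ⊢ₕ A)
  finite-support (hyp h) = _ ∷ [] , h ∷ [] , hyp (here refl)
  finite-support (thm p) = [] , [] , thm p
  finite-support (mpₕ d e) with finite-support d | finite-support e
  ... | Bs , Bs⊆Γ , d′ | Cs , Cs⊆Γ , e′ = Bs ++ Cs , ++⁺ Bs⊆Γ Cs⊆Γ ,
    mpₕ (⊢ₕ-mono (λ _ → ∈-++⁺ˡ) d′)
        (⊢ₕ-mono (λ _ → ∈-++⁺ʳ Bs) e′)

  ⊢ₕ-list⇒⊢-⋀ : ∀ Bs {A} → (_∈ Bs) ⊢ₕ A → L ⊢ ⋀ Bs ⇒ A
  ⊢ₕ-list⇒⊢-⋀ [] d = mp (ax (ax-K _ _)) (⊢ₕ-closed (⊢ₕ-mono (λ _ ()) d))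
  ⊢ₕ-list⇒⊢-⋀ (B ∷ Bs) d = ⊢ₕ-closed (deduction
    (mpₕ (mpₕ (thm (⊢ₕ-list⇒⊢-⋀ Bs (deduction (⊢ₕ-mono ∈-cons d))))
              (∧-elimʳₕ (hyp (inj₁ refl))))
         (∧-elimˡₕ (hyp (inj₁ refl)))))
    where
    ∈-cons : (_∈ B ∷ Bs) ⊆F ((_∈ Bs) ▷ B)
    ∈-cons _ (here X≡B) = inj₁ X≡B
    ∈-cons _ (there X∈) = inj₂ X∈

  ⊢ₕ⇒deducible : ∀ {Γ A} → Γ ⊢ₕ A → Deducible L Γ A
  ⊢ₕ⇒deducible d with finite-support d
  ... | Bs , Bs⊆Γ , d′ = Bs , Bs⊆Γ , ⊢ₕ-list⇒⊢-⋀ Bs d′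

  maxcons-consistent : ∀ {Φ} → MaxCons L Φ → Consistentₕ Φ
  maxcons-consistent (con , _) d = con (⊢ₕ⇒deducible d)

  maxcons-closed : ∀ {Φ A} → MaxCons L Φ → Φ ⊢ₕ A → Φ A
  maxcons-closed {Φ} mc d = proj₂ mc (Φ ⊢ₕ_) (λ _ → hyp)
    (λ d⊥ → maxcons-consistent mc (⊢ₕ-cut (λ _ → id) (deducible⇒⊢ₕ d⊥))) _ d

  -- Adding A exactly when this keeps Γ consistent needs no decision procedure:
  -- the consistency of Γ ▷ A is part of the membership proof.
  addIfConsistent : FSet → Form → FSet
  addIfConsistent Γ A X = Γ X ⊎ (X ≡ A × Consistentₕ (Γ ▷ A))

  addIfConsistent-consistent : ∀ {Γ A} →
    Consistentₕ Γ → Consistentₕ (addIfConsistent Γ A)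
  addIfConsistent-consistent {Γ} {A} con d = con (⊢ₕ-mono into-Γ d)
    where
    into-Γ▷A : addIfConsistent Γ A ⊆F (Γ ▷ A)
    into-Γ▷A _ (inj₁ h)         = inj₂ h
    into-Γ▷A _ (inj₂ (X≡A , _)) = inj₁ X≡A
    into-Γ : addIfConsistent Γ A ⊆F Γ
    into-Γ _ (inj₁ h)             = h
    into-Γ _ (inj₂ (refl , con′)) = ⊥-elim (con′ (⊢ₕ-mono into-Γ▷A d))

  addAll : FSet → List Form → FSet
  addAll Γ []       = Γ
  addAll Γ (A ∷ As) = addAll (addIfConsistent Γ A) As

  addAll-extends : ∀ Γ As → Γ ⊆F addAll Γ As
  addAll-extends Γ []       _ h = h
  addAll-extends Γ (A ∷ As) X h = addAll-extends (addIfConsistent Γ A) As X (inj₁ h)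

  addAll-consistent : ∀ Γ As → Consistentₕ Γ → Consistentₕ (addAll Γ As)
  addAll-consistent Γ []       con = con
  addAll-consistent Γ (A ∷ As) con = addAll-consistent _ As (addIfConsistent-consistent con)

  addAll-decides : ∀ Γ As {A} → A ∈ As → Consistentₕ (addAll Γ As ▷ A) → addAll Γ As A
  addAll-decides Γ (A ∷ As) (here refl) con =
    addAll-extends (addIfConsistent Γ A) As A (inj₂ (refl , λ d → con (⊢ₕ-mono grow d)))
    where
    grow : (Γ ▷ A) ⊆F (addAll (addIfConsistent Γ A) As ▷ A)
    grow _ (inj₁ X≡A) = inj₁ X≡A
    grow X (inj₂ h)   = inj₂ (addAll-extends (addIfConsistent Γ A) As X (inj₁ h))
  addAll-decides Γ (_ ∷ As) (there A∈) con = addAll-decides _ As A∈ con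

  lindenbaum : ∀ {Γ} → Consistentₕ Γ → Σ[ w ∈ WL L ] (Γ ⊆F proj₁ w)
  lindenbaum {Γ} con = (limit , limit-consistent , limit-maximal) , λ _ h → zero , h
    where
    stage : ℕ → FSet
    stage zero    = Γ
    stage (suc n) = addAll (stage n) (formsBelow n)

    limit : FSet
    limit X = Σ[ n ∈ ℕ ] stage n X

    stage-mono : ∀ {m n} → m ≤′ n → stage m ⊆F stage n
    stage-mono ≤′-refl                _ h = h
    stage-mono (≤′-step {n = n} m≤n) X h =
      addAll-extends (stage n) (formsBelow n) X (stage-mono m≤n X h)

    stage-consistent : ∀ n → Consistentₕ (stage n)
    stage-consistent zero    = con
    stage-consistent (suc n) = addAll-consistent (stage n) (formsBelow n) (stage-consistent n)

    limit-compact : ∀ {A} → limit ⊢ₕ A → Σ[ n ∈ ℕ ] stage n ⊢ₕ A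
    limit-compact (hyp (n , h)) = n , hyp h
    limit-compact (thm p)       = zero , thm p
    limit-compact (mpₕ d e) with limit-compact d | limit-compact e
    ... | m , d′ | n , e′ = m ⊔ n , mpₕ (⊢ₕ-mono (stage-mono (≤⇒≤′ (m≤m⊔n m n))) d′)
                                        (⊢ₕ-mono (stage-mono (≤⇒≤′ (m≤n⊔m m n))) e′)

    limit-consistent : Consistent L limit
    limit-consistent d with limit-compact (deducible⇒⊢ₕ d)
    ... | n , d′ = stage-consistent n d′

    limit-maximal : ∀ Δ → limit ⊆F Δ → Consistent L Δ → Δ ⊆F limit
    limit-maximal Δ limit⊆Δ conΔ A A∈Δ with ∈-formsBelow A
    ... | n , A∈ = suc n , addAll-decides (stage n) (formsBelow n) A∈
      (λ d → conΔ (⊢ₕ⇒deducible (⊢ₕ-mono into-Δ d)))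
      where
      into-Δ : (stage (suc n) ▷ A) ⊆F Δ
      into-Δ _ (inj₁ refl) = A∈Δ
      into-Δ X (inj₂ h)    = limit⊆Δ X (suc n , h)

  negations-support : ∀ {Θ S A} → (Θ ∪ negations S) ⊢ₕ A →
    Σ[ Ds ∈ List Form ] (All S Ds × (Θ ∪ negations (_∈ Ds)) ⊢ₕ A)
  negations-support (hyp (inj₁ h)) = [] , [] , hyp (inj₁ h)
  negations-support (hyp (inj₂ (D , D∈S , eq))) =
    D ∷ [] , D∈S ∷ [] , hyp (inj₂ (D , here refl , eq))
  negations-support (thm p)        = [] , [] , thm p
  negations-support {Θ} (mpₕ d e) with negations-support d | negations-support e
  ... | Ds , Ds⊆S , d′ | Es , Es⊆S , e′ =
    Ds ++ Es , ++⁺ Ds⊆S Es⊆S , mpₕ (⊢ₕ-mono (widen (λ _ → ∈-++⁺ˡ)) d′)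
                                   (⊢ₕ-mono (widen (λ _ → ∈-++⁺ʳ Ds)) e′)
    where
    widen : ∀ {S T} → S ⊆F T → (Θ ∪ negations S) ⊆F (Θ ∪ negations T)
    widen S⊆T _ (inj₁ h)              = inj₁ h
    widen S⊆T _ (inj₂ (D , D∈S , eq)) = inj₂ (D , S⊆T D D∈S , eq)

  refuted-negations⇒⋁ : ∀ {Θ} Ds → (Θ ∪ negations (_∈ Ds)) ⊢ₕ ⊥' → Θ ⊢ₕ ⋁ Ds
  refuted-negations⇒⋁ {Θ} [] d = ⊢ₕ-mono drop-negations d
    where
    drop-negations : (Θ ∪ negations (_∈ [])) ⊆F Θ
    drop-negations _ (inj₁ h) = h
    drop-negations _ (inj₂ (_ , () , _))
  refuted-negations⇒⋁ {Θ} (D ∷ Ds) d = deduction (refuted-negations⇒⋁ Ds (⊢ₕ-mono shift d))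
    where
    shift : (Θ ∪ negations (_∈ D ∷ Ds)) ⊆F ((Θ ▷ ¬' D) ∪ negations (_∈ Ds))
    shift _ (inj₁ h)                    = inj₁ (inj₂ h)
    shift _ (inj₂ (_ , here refl , eq)) = inj₁ (inj₁ eq)
    shift _ (inj₂ (E , there E∈ , eq))  = inj₂ (E , E∈ , eq)

  world-avoiding : ∀ {A S} → (∀ Ds → All S Ds → ¬ (L ⊢ A ⇒ ⋁ Ds)) →
    Σ[ w ∈ WL L ] (proj₁ w A × Compl L S w)
  world-avoiding {A} {S} separated with lindenbaum consistent
    where
    consistent : Consistentₕ ((∅ ▷ A) ∪ negations S)
    consistent d with negations-support d
    ... | Ds , Ds⊆S , d′ =
      separated Ds Ds⊆S (⊢ₕ-closed (deduction (refuted-negations⇒⋁ Ds d′)))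
  ... | (Ψ , mc) , seed⊆Ψ = (Ψ , mc) , seed⊆Ψ A (inj₁ (inj₁ refl)) ,
    λ D D∈S D∈Ψ →
      maxcons-consistent mc (mpₕ (hyp (seed⊆Ψ _ (inj₂ (D , D∈S , refl)))) (hyp D∈Ψ))

  ∈-cpr : ∀ {Φ A B} → MaxCons L Φ → L ⊢ A ⇒ B → Φ (B ≼ A)
  ∈-cpr mc ⊢A⇒B = maxcons-closed mc (thm (cpr ⊢A⇒B))

  ∈-≼-trans : ∀ {Φ A B C} → MaxCons L Φ → Φ (A ≼ B) → Φ (B ≼ C) → Φ (A ≼ C)
  ∈-≼-trans mc A≼B B≼C =
    maxcons-closed mc (mpₕ (thm (ax (ax-tr _ _ _))) (∧-introₕ (hyp A≼B) (hyp B≼C)))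

  ∈-≼-⋁ : ∀ {Φ B} → MaxCons L Φ → ∀ {Ds} → All (λ D → Φ (B ≼ D)) Ds → Φ (B ≼ ⋁ Ds)
  ∈-≼-⋁ mc []       = ∈-cpr mc (⊢ₕ-closed (deduction (⊥-elimₕ (hyp (inj₁ refl)))))
  ∈-≼-⋁ mc (B≼D ∷ ps) =
    maxcons-closed mc
      (mpₕ (thm (ax (ax-or _ _ _))) (∧-introₕ (hyp B≼D) (hyp (∈-≼-⋁ mc ps))))

  ≼-upset-cut : ∀ {Φ} (mc : MaxCons L Φ) B → Cut L (Φ , mc) (λ D → Φ (B ≼ D))
  ≼-upset-cut mc B Ds A Ds⊆S A∉S ⋁Ds≼A = A∉S (∈-≼-trans mc (∈-≼-⋁ mc Ds⊆S) ⋁Ds≼A)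

  module _ (lem : ExcludedMiddle (lsuc 0ℓ)) where

    decide : (P : Set) → Dec P
    decide P = map′ lower lift (lem {Lift (lsuc 0ℓ) P})

    maxcons-¬ : ∀ {Φ A} → MaxCons L Φ → ¬ Φ A → Φ (¬' A)
    maxcons-¬ {Φ} {A} mc A∉Φ with decide ((Φ ▷ A) ⊢ₕ ⊥')
    ... | yes d  = maxcons-closed mc (deduction d)
    ... | no ¬d = ⊥-elim (A∉Φ
      (proj₂ mc (Φ ▷ A) (λ _ → inj₂) (λ d → ¬d (deducible⇒⊢ₕ d)) A (inj₁ refl)))

    ∈-⇒⁺ : ∀ {Φ A B} → MaxCons L Φ → (Φ A → Φ B) → Φ (A ⇒ B)
    ∈-⇒⁺ {Φ} {A} mc A→B with decide (Φ A)
    ... | yes A∈Φ = maxcons-closed mc (mpₕ (thm (ax (ax-K _ _))) (hyp (A→B A∈Φ)))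
    ... | no A∉Φ  = maxcons-closed mc
      (deduction (⊥-elimₕ (mpₕ (hyp (inj₂ (maxcons-¬ mc A∉Φ))) (hyp (inj₁ refl)))))

    ∈-⇒⁻ : ∀ {Φ A B} → MaxCons L Φ → Φ (A ⇒ B) → Φ A → Φ B
    ∈-⇒⁻ mc A⇒B A = maxcons-closed mc (mpₕ (hyp A⇒B) (hyp A))

    infix 2 _⊩ᶜ_
    _⊩ᶜ_ : WL L → Form → Set₁
    _⊩ᶜ_ = _⊩_ (Canonical L)

    TruthLemma : Form → Set₁
    TruthLemma A = ∀ w → (w ⊩ᶜ A) ⇔ proj₁ w A

    ≼-forced : ∀ {B C} → TruthLemma B → TruthLemma C →
      ∀ w → proj₁ w (B ≼ C) → w ⊩ᶜ B ≼ C
    ≼-forced {B} {C} ihB ihC (Φ , mc) B≼C α (S , S-cut , _ , α⇔Sᶜ) (v , αv , v⊩C) =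
      B-world (world-avoiding B-separated)
      where
      C∉S : ¬ S C
      C∉S C∈S = to (α⇔Sᶜ v) αv C C∈S (to (ihC v) v⊩C)
      B-separated : ∀ Ds → All S Ds → ¬ (L ⊢ B ⇒ ⋁ Ds)
      B-separated Ds Ds⊆S ⊢B⇒⋁Ds =
        S-cut Ds C Ds⊆S C∉S (∈-≼-trans mc (∈-cpr mc ⊢B⇒⋁Ds) B≼C)
      B-world : Σ[ u ∈ WL L ] (proj₁ u B × Compl L S u) → Σ[ u ∈ WL L ] (α u × (u ⊩ᶜ B))
      B-world (u , B∈u , u∈Sᶜ) = u , from (α⇔Sᶜ u) u∈Sᶜ , from (ihB u) B∈u

    ≼-member : ∀ {B C} → TruthLemma B → TruthLemma C →
      ∀ w → w ⊩ᶜ B ≼ C → proj₁ w (B ≼ C)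
    ≼-member {B} {C} ihB ihC (Φ , mc) forced with decide (Φ (B ≼ C))
    ... | yes B≼C = B≼C
    ... | no B⋠C  = ⊥-elim (refute (world-avoiding C-separated))
      where
      S : FSet
      S D = Φ (B ≼ D)
      C-separated : ∀ Ds → All S Ds → ¬ (L ⊢ C ⇒ ⋁ Ds)
      C-separated Ds Ds⊆S ⊢C⇒⋁Ds =
        B⋠C (∈-≼-trans mc (∈-≼-⋁ mc Ds⊆S) (∈-cpr mc ⊢C⇒⋁Ds))
      no-B-world : Σ[ u ∈ WL L ] (Compl L S u × (u ⊩ᶜ B)) → ⊥
      no-B-world (u , u∈Sᶜ , u⊩B) = u∈Sᶜ B (∈-cpr mc (⊢-identity B)) (to (ihB u) u⊩B)
      refute : Σ[ w ∈ WL L ] (proj₁ w C × Compl L S w) → ⊥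
      refute (w , C∈w , w∈Sᶜ) = no-B-world (forced (Compl L S)
        (S , ≼-upset-cut mc B , (w , w∈Sᶜ) , λ _ → mk⇔ id id)
        (w , w∈Sᶜ , from (ihC w) C∈w))

    truth : ∀ A → TruthLemma A
    truth (atom p) _        = mk⇔ lower lift
    truth ⊥' (_ , mc)       =
      mk⇔ (λ { (lift ()) }) (λ ⊥∈Φ → lift (maxcons-consistent mc (hyp ⊥∈Φ)))
    truth (B ⇒ C) (Φ , mc)  = mk⇔
      (λ ⊩B→⊩C → ∈-⇒⁺ mc (λ B∈Φ → to (truth C _) (⊩B→⊩C (from (truth B _) B∈Φ))))
      (λ B⇒C∈Φ ⊩B → from (truth C _) (∈-⇒⁻ mc B⇒C∈Φ (to (truth B _) ⊩B)))
    truth (B ≼ C) w = mk⇔ (≼-member (truth B) (truth C) w) (≼-forced (truth B) (truth C) w)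

lemma3p7 : ExcludedMiddle (lsuc 0ℓ) →
    ∀ (L : Logic) (A : Form) (Φ : WL L) →
    (_⊩_ (Canonical L) Φ A) ⇔ proj₁ Φ A
lemma3p7 lem L A Φ = truth L lem A Φ
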